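{- Let $\mathcal D=(d_1,\dots,d_n)$ be a non-increasing degree sequence of a simple graph with $m\ge1$ edges. Then $M_2$ and $Z_2$ are non-decreasing along arcs of $G(\mathcal D)$: if there is an arc $\mathbf A\to\mathbf A'$ in $G(\mathcal D)$, then $M_2(\mathbf A')\ge M_2(\mathbf A)$ and $Z_2(\mathbf A')\ge Z_2(\mathbf A)$.
   Context: $\mathcal M(\mathcal D)$ is the set of symmetric $n\times n$ $(0,1)$-matrices with zero diagonal and row sums $\mathcal D$. For pairwise distinct $i,j,k,l$ with $i<j$, $k<l$, $\mathcal C_{ijkl}$ has entries $+1$ at $(i,k),(k,i),(j,l),(l,j)$, $-1$ at $(i,l),(l,i),(j,k),(k,j)$, $0$ elsewhere; a positive switch replaces $\mathbf A$ by $\mathbf A+\mathcal C_{ijkl}\in\mathcal M(\mathcal D)$. $G(\mathcal D)$ is the directed graph on $\mathcal M(\mathcal D)$ with an arc $\mathbf A\to\mathbf A'$ when $\mathbf A'$ is obtained from $\mathbf A$ by one positive switch. For $\mathbf A$ with edge set $E$ ($|E|=m$), $M_2(\mathbf A)=\sum_{\{u,v\}\in E}d_ud_v$ and $Z_2(\mathbf A)=\sqrt{M_2(\mathbf A)/m}$. -}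

module Defs where

open import Data.Nat using (ℕ; zero; suc; _+_; _*_; _≤_; _<_)
open import Data.Fin using (Fin) renaming (_<_ to _<ᶠ_; _≤_ to _≤ᶠ_)
open import Data.Fin.Properties using (_≟_)
open import Data.Integer as ℤ using (ℤ; +_; -[1+_])
open import Data.Rational as ℚ using (ℚ; 0ℚ)
open import Data.List using (List; map; allFin)
open import Data.Nat.ListAction using (sum)
open import Data.Sum using (_⊎_)
open import Data.Product using (_×_)
open import Data.Bool using (Bool; true; false; _∧_)
open import Relation.Nullary using (¬_; yes; no; does)
open import Relation.Binary.PropositionalEquality using (_≡_)

Σ[_] : (n : ℕ) → (Fin n → ℕ) → ℕ
Σ[ n ] f = sum (map f (allFin n))

Mat : ℕ → Set
Mat n = Fin n → Fin n → ℕ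

record InM {n : ℕ} (D : Fin n → ℕ) (A : Mat n) : Set where
  field
    zeroOne   : ∀ x y → A x y ≡ 0 ⊎ A x y ≡ 1
    symmetric : ∀ x y → A x y ≡ A y x
    zeroDiag  : ∀ x → A x x ≡ 0
    rowSums   : ∀ x → Σ[ n ] (A x) ≡ D x

NonIncreasing : {n : ℕ} → (Fin n → ℕ) → Set
NonIncreasing {n} D = ∀ (x y : Fin n) → x ≤ᶠ y → D y ≤ D x

PairwiseDistinct : {n : ℕ} → Fin n → Fin n → Fin n → Fin n → Set
PairwiseDistinct i j k l =
  ¬ i ≡ j × ¬ i ≡ k × ¬ i ≡ l × ¬ j ≡ k × ¬ j ≡ l × ¬ k ≡ l

pairIs : {n : ℕ} → Fin n → Fin n → Fin n → Fin n → Bool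
pairIs x y a b =
  (does (x ≟ a) ∧ does (y ≟ b)) Data.Bool.∨ (does (x ≟ b) ∧ does (y ≟ a))

C : {n : ℕ} → Fin n → Fin n → Fin n → Fin n → Fin n → Fin n → ℤ
C i j k l x y with pairIs x y i k Data.Bool.∨ pairIs x y j l
... | true = + 1
... | false with pairIs x y i l Data.Bool.∨ pairIs x y j k
...   | true = -[1+ 0 ]
...   | false = + 0

PositiveSwitch : {n : ℕ} → (D : Fin n → ℕ) → Mat n → Mat n → Set
PositiveSwitch {n} D A A' =
  InM D A × InM D A' ×
  Data.Product.Σ (Fin n) λ i → Data.Product.Σ (Fin n) λ j →
  Data.Product.Σ (Fin n) λ k → Data.Product.Σ (Fin n) λ l →
    PairwiseDistinct i j k l × i <ᶠ j × k <ᶠ l ×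
    (∀ x y → + A' x y ≡ (+ A x y) ℤ.+ C i j k l x y)

Arc : {n : ℕ} → (D : Fin n → ℕ) → Mat n → Mat n → Set
Arc = PositiveSwitch

edges : {n : ℕ} → Mat n → ℕ
edges {n} A = Σ[ n ] λ u → Σ[ n ] λ v → if does (Data.Fin._<?_ u v) then A u v else 0
  where open import Data.Bool using (if_then_else_)

-- second Zagreb index M₂ = Σ_{uv ∈ E} d_u d_v, with d_u = D u the row sum
M2 : {n : ℕ} → (D : Fin n → ℕ) → Mat n → ℕ
M2 {n} D A = Σ[ n ] λ u → Σ[ n ] λ v →
  if does (Data.Fin._<?_ u v) then A u v * (D u * D v) else 0
  where open import Data.Bool using (if_then_else_)

-- Z₂² = M₂ / m as a rational (m ≥ 1; defined as 0 when there are no edges)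
Z2sq : {n : ℕ} → (D : Fin n → ℕ) → Mat n → ℚ
Z2sq D A with edges A
... | zero = 0ℚ
... | suc k = (+ M2 D A) ℚ./ suc k

-- A positive switch deletes the edges il, jk and inserts ik, jl, so for every symmetric
-- weight w the edge sum Σ_{uv ∈ E} w_uv grows by w_ik + w_jl − w_il − w_jk. For
-- w_uv = d_u d_v this is (d_i − d_j)(d_k − d_l) ≥ 0, since D is non-increasing, i < j and
-- k < l; for w = 1 it is 0, so m is unchanged and Z₂² = M₂/m grows with M₂.
module Submission where

open import Defs
open import Data.Nat using (ℕ; _≤_)
open import Data.Nat using (zero; suc; _+_; _*_; _∸_)
open import Data.Fin using (Fin)
open import Data.Product using (_×_)
open import Data.Rational as ℚ using (ℚ)

open import Data.Bool using (Bool; true; false; T; _∧_; _∨_; if_then_else_)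
open import Data.Bool.Properties using (T-∨; ∧-zeroʳ)
open import Data.Empty using (⊥; ⊥-elim)
open import Data.Fin using (zero; suc; _<?_)
open import Data.Fin.Properties using (_≟_; suc-injective; <-cmp)
import Data.Integer as ℤ
import Data.Integer.Properties as ℤ
import Data.Integer.Solver as ℤ-Solver
open import Data.List using (map; tabulate)
import Data.Nat.ListAction as List
open import Data.Nat.Properties
  using (+-identityʳ; *-identityʳ; *-comm; *-distribʳ-+; m≤m+n; m+[n∸m]≡n; <⇒≤;
         +-monoʳ-≤; *-monoˡ-≤; +-cancelʳ-≤; +-cancelʳ-≡; +-0-commutativeMonoid)
open import Algebra.Properties.CommutativeMonoid.Sum +-0-commutativeMonoid
  using (sum-syntax; ∑-distrib-+; sum-cong-≗; sum-replicate-zero)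
import Data.Nat.Solver as ℕ-Solver
open import Data.Product using (_,_; proj₁; proj₂)
open import Data.Sum using (_⊎_; inj₁; inj₂)
open import Function using (_∘_; id; _$_)
open import Function.Bundles using (Equivalence)
open import Relation.Binary.Definitions using (tri<; tri≈; tri>)
open import Relation.Binary.PropositionalEquality hiding ([_])
open import Relation.Nullary using (¬_; yes; does)
open import Relation.Nullary.Decidable using (dec-true; dec-false)
import Data.Rational.Properties as ℚ
import Data.Rational.Unnormalised as ℚᵘ
import Data.Rational.Unnormalised.Properties as ℚᵘ

private
  variable
    n : ℕ

[_] : Bool → ℕ
[ b ] = if b then 1 else 0

Exclusive : Bool → Bool → Set
Exclusive x y = T x → T y → ⊥

[]-∨-exclusive : ∀ {x y} → Exclusive x y → [ x ∨ y ] ≡ [ x ] + [ y ]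
[]-∨-exclusive {true}  {true}  excl = ⊥-elim (excl _ _)
[]-∨-exclusive {true}  {false} _    = refl
[]-∨-exclusive {false} {_}     _    = refl

∨-exclusive : ∀ {x y z w} → Exclusive x z → Exclusive x w → Exclusive y z → Exclusive y w →
              Exclusive (x ∨ y) (z ∨ w)
∨-exclusive xz xw yz yw p q with Equivalence.to T-∨ p | Equivalence.to T-∨ q
... | inj₁ tx | inj₁ tz = xz tx tz
... | inj₁ tx | inj₂ tw = xw tx tw
... | inj₂ ty | inj₁ tz = yz ty tz
... | inj₂ ty | inj₂ tw = yw ty tw

≟-∧-sound : {u v a b : Fin n} → T (does (u ≟ a) ∧ does (v ≟ b)) → u ≡ a × v ≡ b
≟-∧-sound {u = u} {v} {a} {b} t with u ≟ a | v ≟ b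
... | yes u≡a | yes v≡b = u≡a , v≡b

Σ-tabulate : ∀ {m} (g : Fin n → Fin m) (f : Fin m → ℕ) →
             List.sum (map f (tabulate g)) ≡ ∑[ x < n ] f (g x)
Σ-tabulate {zero}  g f = refl
Σ-tabulate {suc n} g f = cong (f (g zero) +_) (Σ-tabulate (g ∘ suc) f)

Σ≡∑ : (f : Fin n → ℕ) → Σ[ n ] f ≡ ∑[ x < n ] f x
Σ≡∑ = Σ-tabulate id

∑-zero : (f : Fin n → ℕ) → (∀ x → f x ≡ 0) → ∑[ x < n ] f x ≡ 0
∑-zero {n} f f≡0 = trans (sum-cong-≗ f≡0) (sum-replicate-zero n)

∑-single : (a : Fin n) (f : Fin n → ℕ) → (∀ x → x ≢ a → f x ≡ 0) → ∑[ x < n ] f x ≡ f a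
∑-single {suc n} zero f vanish =
  trans (cong (f zero +_) (∑-zero (f ∘ suc) λ x → vanish (suc x) λ ())) (+-identityʳ (f zero))
∑-single {suc n} (suc a) f vanish =
  cong₂ _+_ (vanish zero λ ())
            (∑-single a (f ∘ suc) λ x x≢a → vanish (suc x) (x≢a ∘ suc-injective))

_⊕_ _⊙_ : Mat n → Mat n → Mat n
(B ⊕ B′) u v = B u v + B′ u v
(B ⊙ B′) u v = B u v * B′ u v

infixl 6 _⊕_
infixl 7 _⊙_

above : Fin n → Fin n → ℕ → ℕ
above u v x = if does (u <? v) then x else 0

above-0 : (u v : Fin n) → above u v 0 ≡ 0
above-0 u v with does (u <? v)
... | true  = refl
... | false = refl

above-+ : (u v : Fin n) (x y : ℕ) → above u v (x + y) ≡ above u v x + above u v y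
above-+ u v x y with does (u <? v)
... | true  = refl
... | false = refl

above-complementary : {a b : Fin n} (x : ℕ) → a ≢ b → above a b x + above b a x ≡ x
above-complementary {a = a} {b} x a≢b with <-cmp a b
... | tri< a<b _ b≮a rewrite dec-true (a <? b) a<b | dec-false (b <? a) b≮a = +-identityʳ x
... | tri≈ _ a≡b _ = ⊥-elim (a≢b a≡b)
... | tri> a≮b _ b<a rewrite dec-false (a <? b) a≮b | dec-true (b <? a) b<a = refl

upperSum : Mat n → ℕ
upperSum {n} B = ∑[ u < n ] ∑[ v < n ] above u v (B u v)

Σ²≡upperSum : (B : Mat n) →
  (Σ[ n ] λ u → Σ[ n ] λ v → if does (u <? v) then B u v else 0) ≡ upperSum B
Σ²≡upperSum {n} B =
  trans (Σ≡∑ λ u → Σ[ n ] λ v → above u v (B u v))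
        (sum-cong-≗ {n} λ u → Σ≡∑ λ v → above u v (B u v))

upperSum-cong : {B B′ : Mat n} → (∀ u v → B u v ≡ B′ u v) → upperSum B ≡ upperSum B′
upperSum-cong {n} B≡B′ = sum-cong-≗ {n} λ u → sum-cong-≗ {n} λ v → cong (above u v) (B≡B′ u v)

upperSum-⊕ : (B B′ : Mat n) → upperSum (B ⊕ B′) ≡ upperSum B + upperSum B′
upperSum-⊕ {n} B B′ = begin
  upperSum (B ⊕ B′)
    ≡⟨ sum-cong-≗ {n} (λ u → sum-cong-≗ {n} λ v → above-+ u v (B u v) (B′ u v)) ⟩
  ∑[ u < n ] ∑[ v < n ] (above u v (B u v) + above u v (B′ u v))
    ≡⟨ sum-cong-≗ {n} (λ u → ∑-distrib-+ (λ v → above u v (B u v)) (λ v → above u v (B′ u v))) ⟩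
  ∑[ u < n ] (∑[ v < n ] above u v (B u v) + ∑[ v < n ] above u v (B′ u v))
    ≡⟨ ∑-distrib-+ (λ u → ∑[ v < n ] above u v (B u v)) (λ u → ∑[ v < n ] above u v (B′ u v)) ⟩
  upperSum B + upperSum B′ ∎
  where open ≡-Reasoning

upperSum-⊕⊙ : (B B′ w : Mat n) →
              upperSum ((B ⊕ B′) ⊙ w) ≡ upperSum (B ⊙ w) + upperSum (B′ ⊙ w)
upperSum-⊕⊙ B B′ w =
  trans (upperSum-cong λ u v → *-distribʳ-+ (w u v) (B u v) (B′ u v)) (upperSum-⊕ (B ⊙ w) (B′ ⊙ w))

entry : Fin n → Fin n → Mat n
entry a b u v = [ does (u ≟ a) ∧ does (v ≟ b) ]

upperSum-entry : (a b : Fin n) (w : Mat n) → upperSum (entry a b ⊙ w) ≡ above a b (w a b)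
upperSum-entry {n} a b w = begin
  upperSum (entry a b ⊙ w)                     ≡⟨ ∑-single a _ outside-row ⟩
  ∑[ v < n ] above a v ((entry a b ⊙ w) a v)   ≡⟨ ∑-single b _ outside-column ⟩
  above a b ((entry a b ⊙ w) a b)              ≡⟨ cong (above a b) on-entry ⟩
  above a b (w a b)                            ∎
  where
  open ≡-Reasoning
  outside-row : ∀ u → u ≢ a → ∑[ v < n ] above u v ((entry a b ⊙ w) u v) ≡ 0
  outside-row u u≢a = ∑-zero {n} _ λ v →
    trans (cong (λ d → above u v ([ d ∧ does (v ≟ b) ] * w u v)) (dec-false (u ≟ a) u≢a)) (above-0 u v)
  outside-column : ∀ v → v ≢ b → above a v ((entry a b ⊙ w) a v) ≡ 0
  outside-column v v≢b =
    trans (cong (λ d → above a v ([ does (a ≟ a) ∧ d ] * w a v)) (dec-false (v ≟ b) v≢b))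
          (trans (cong (λ d → above a v ([ d ] * w a v)) (∧-zeroʳ (does (a ≟ a)))) (above-0 a v))
  on-entry : (entry a b ⊙ w) a b ≡ w a b
  on-entry = trans (cong₂ (λ d e → [ d ∧ e ] * w a b) (dec-true (a ≟ a) refl) (dec-true (b ≟ b) refl))
                   (+-identityʳ (w a b))

pairIs-cases : {u v a b : Fin n} → T (pairIs u v a b) → (u ≡ a × v ≡ b) ⊎ (u ≡ b × v ≡ a)
pairIs-cases t with Equivalence.to T-∨ t
... | inj₁ t₁ = inj₁ (≟-∧-sound t₁)
... | inj₂ t₂ = inj₂ (≟-∧-sound t₂)

pairIs-exclusive : (u v : Fin n) {a b c d : Fin n} → ¬ (a ≡ c × b ≡ d) → ¬ (a ≡ d × b ≡ c) →
                   Exclusive (pairIs u v a b) (pairIs u v c d)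
pairIs-exclusive u v {a} {b} {c} {d} ac×bd ad×bc t t′
  with pairIs-cases {u = u} {v} {a} {b} t | pairIs-cases {u = u} {v} {c} {d} t′
... | inj₁ (refl , refl) | inj₁ (refl , refl) = ac×bd (refl , refl)
... | inj₁ (refl , refl) | inj₂ (refl , refl) = ad×bc (refl , refl)
... | inj₂ (refl , refl) | inj₁ (refl , refl) = ad×bc (refl , refl)
... | inj₂ (refl , refl) | inj₂ (refl , refl) = ac×bd (refl , refl)

pairMat : Fin n → Fin n → Mat n
pairMat a b u v = [ pairIs u v a b ]

pairMat-entries : {a b : Fin n} → a ≢ b → ∀ u v → pairMat a b u v ≡ (entry a b ⊕ entry b a) u v
pairMat-entries {a = a} {b} a≢b u v = []-∨-exclusive {does (u ≟ a) ∧ does (v ≟ b)} λ t t′ →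
  a≢b (trans (sym (proj₁ (≟-∧-sound {u = u} {v} t))) (proj₁ (≟-∧-sound {u = u} {v} t′)))

upperSum-pairMat : {a b : Fin n} (w : Mat n) → a ≢ b → (∀ u v → w u v ≡ w v u) →
                   upperSum (pairMat a b ⊙ w) ≡ w a b
upperSum-pairMat {a = a} {b} w a≢b w-sym = begin
  upperSum (pairMat a b ⊙ w)
    ≡⟨ upperSum-cong (λ u v → cong (_* w u v) (pairMat-entries a≢b u v)) ⟩
  upperSum ((entry a b ⊕ entry b a) ⊙ w)
    ≡⟨ upperSum-⊕⊙ (entry a b) (entry b a) w ⟩
  upperSum (entry a b ⊙ w) + upperSum (entry b a ⊙ w)
    ≡⟨ cong₂ _+_ (upperSum-entry a b w) (upperSum-entry b a w) ⟩
  above a b (w a b) + above b a (w b a)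
    ≡⟨ cong (λ x → above a b (w a b) + above b a x) (w-sym b a) ⟩
  above a b (w a b) + above b a (w a b)
    ≡⟨ above-complementary (w a b) a≢b ⟩
  w a b ∎
  where open ≡-Reasoning

x≡y+[p-q]⇒x+q≡y+p : ∀ {x y p q} → ℤ.+ x ≡ ℤ.+ y ℤ.+ (ℤ.+ p ℤ.- ℤ.+ q) → x + q ≡ y + p
x≡y+[p-q]⇒x+q≡y+p {x} {y} {p} {q} eq = ℤ.+-injective $ begin
  ℤ.+ (x + q)                            ≡⟨ ℤ.pos-+ x q ⟩
  ℤ.+ x ℤ.+ ℤ.+ q                        ≡⟨ cong (ℤ._+ ℤ.+ q) eq ⟩
  ℤ.+ y ℤ.+ (ℤ.+ p ℤ.- ℤ.+ q) ℤ.+ ℤ.+ q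
    ≡⟨ solve 3 (λ y p q → y :+ (p :- q) :+ q := y :+ p) refl (ℤ.+ y) (ℤ.+ p) (ℤ.+ q) ⟩
  ℤ.+ y ℤ.+ ℤ.+ p                        ≡⟨ ℤ.pos-+ y p ⟨
  ℤ.+ (y + p)                            ∎
  where
  open ≡-Reasoning
  open ℤ-Solver.+-*-Solver

C-indicators : (i j k l u v : Fin n) →
  Exclusive (pairIs u v i k ∨ pairIs u v j l) (pairIs u v i l ∨ pairIs u v j k) →
  C i j k l u v ≡
    ℤ.+ [ pairIs u v i k ∨ pairIs u v j l ] ℤ.- ℤ.+ [ pairIs u v i l ∨ pairIs u v j k ]
C-indicators i j k l u v excl with pairIs u v i k ∨ pairIs u v j l
... | true with pairIs u v i l ∨ pairIs u v j k
...   | true  = ⊥-elim (excl _ _)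
...   | false = refl
C-indicators i j k l u v excl | false with pairIs u v i l ∨ pairIs u v j k
...   | true  = refl
...   | false = refl

module _ {i j k l : Fin n} (distinct : PairwiseDistinct i j k l) where

  private
    i≢j : i ≢ j
    i≢j = proj₁ distinct
    i≢k : i ≢ k
    i≢k = proj₁ (proj₂ distinct)
    i≢l : i ≢ l
    i≢l = proj₁ (proj₂ (proj₂ distinct))
    j≢k : j ≢ k
    j≢k = proj₁ (proj₂ (proj₂ (proj₂ distinct)))
    j≢l : j ≢ l
    j≢l = proj₁ (proj₂ (proj₂ (proj₂ (proj₂ distinct))))
    k≢l : k ≢ l
    k≢l = proj₂ (proj₂ (proj₂ (proj₂ (proj₂ distinct))))

  switch-pointwise : (A A′ : Mat n) (u v : Fin n) → ℤ.+ A′ u v ≡ ℤ.+ A u v ℤ.+ C i j k l u v →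
    (A′ ⊕ (pairMat i l ⊕ pairMat j k)) u v ≡ (A ⊕ (pairMat i k ⊕ pairMat j l)) u v
  switch-pointwise A A′ u v A′≡A+C = begin
    A′ u v + ([ pairIs u v i l ] + [ pairIs u v j k ]) ≡⟨ cong (A′ u v +_) ([]-∨-exclusive il#jk) ⟨
    A′ u v + [ pairIs u v i l ∨ pairIs u v j k ]       ≡⟨ x≡y+[p-q]⇒x+q≡y+p A′≡A+P-Q ⟩
    A u v + [ pairIs u v i k ∨ pairIs u v j l ]        ≡⟨ cong (A u v +_) ([]-∨-exclusive ik#jl) ⟩
    A u v + ([ pairIs u v i k ] + [ pairIs u v j l ])  ∎
    where
    open ≡-Reasoning
    ik#jl : Exclusive (pairIs u v i k) (pairIs u v j l)
    ik#jl = pairIs-exclusive u v (i≢j ∘ proj₁) (i≢l ∘ proj₁)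
    il#jk : Exclusive (pairIs u v i l) (pairIs u v j k)
    il#jk = pairIs-exclusive u v (i≢j ∘ proj₁) (i≢k ∘ proj₁)
    ik#il : Exclusive (pairIs u v i k) (pairIs u v i l)
    ik#il = pairIs-exclusive u v (k≢l ∘ proj₂) (i≢l ∘ proj₁)
    ik#jk : Exclusive (pairIs u v i k) (pairIs u v j k)
    ik#jk = pairIs-exclusive u v (i≢j ∘ proj₁) (i≢k ∘ proj₁)
    jl#il : Exclusive (pairIs u v j l) (pairIs u v i l)
    jl#il = pairIs-exclusive u v (i≢j ∘ sym ∘ proj₁) (j≢l ∘ proj₁)
    jl#jk : Exclusive (pairIs u v j l) (pairIs u v j k)
    jl#jk = pairIs-exclusive u v (k≢l ∘ sym ∘ proj₂) (j≢k ∘ proj₁)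
    A′≡A+P-Q : ℤ.+ A′ u v ≡ ℤ.+ A u v ℤ.+ (ℤ.+ [ pairIs u v i k ∨ pairIs u v j l ]
                                          ℤ.- ℤ.+ [ pairIs u v i l ∨ pairIs u v j k ])
    A′≡A+P-Q = trans A′≡A+C $ cong (ℤ._+_ (ℤ.+ A u v)) $
      C-indicators i j k l u v (∨-exclusive ik#il ik#jk jl#il jl#jk)

  upperSum-switch : (w : Mat n) → (∀ u v → w u v ≡ w v u) → (A A′ : Mat n) →
    (∀ u v → ℤ.+ A′ u v ≡ ℤ.+ A u v ℤ.+ C i j k l u v) →
    upperSum (A′ ⊙ w) + (w i l + w j k) ≡ upperSum (A ⊙ w) + (w i k + w j l)
  upperSum-switch w w-sym A A′ A′≡A+C = begin
    upperSum (A′ ⊙ w) + (w i l + w j k)                       ≡⟨ add-pairs A′ i≢l j≢k ⟨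
    upperSum ((A′ ⊕ (pairMat i l ⊕ pairMat j k)) ⊙ w)
      ≡⟨ upperSum-cong (λ u v → cong (_* w u v) (switch-pointwise A A′ u v (A′≡A+C u v))) ⟩
    upperSum ((A ⊕ (pairMat i k ⊕ pairMat j l)) ⊙ w)          ≡⟨ add-pairs A i≢k j≢l ⟩
    upperSum (A ⊙ w) + (w i k + w j l)                        ∎
    where
    open ≡-Reasoning
    add-pairs : (B : Mat n) {a b c d : Fin n} → a ≢ b → c ≢ d →
      upperSum ((B ⊕ (pairMat a b ⊕ pairMat c d)) ⊙ w) ≡ upperSum (B ⊙ w) + (w a b + w c d)
    add-pairs B {a} {b} {c} {d} a≢b c≢d = begin
      upperSum ((B ⊕ (pairMat a b ⊕ pairMat c d)) ⊙ w)
        ≡⟨ upperSum-⊕⊙ B _ w ⟩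
      upperSum (B ⊙ w) + upperSum ((pairMat a b ⊕ pairMat c d) ⊙ w)
        ≡⟨ cong (upperSum (B ⊙ w) +_) (upperSum-⊕⊙ (pairMat a b) (pairMat c d) w) ⟩
      upperSum (B ⊙ w) + (upperSum (pairMat a b ⊙ w) + upperSum (pairMat c d ⊙ w))
        ≡⟨ cong (upperSum (B ⊙ w) +_) (cong₂ _+_ (upperSum-pairMat w a≢b w-sym)
                                                  (upperSum-pairMat w c≢d w-sym)) ⟩
      upperSum (B ⊙ w) + (w a b + w c d) ∎

rearrangement : ∀ {x y s t} → y ≤ x → t ≤ s → x * t + y * s ≤ x * s + y * t
rearrangement {x} {y} {s} {t} y≤x t≤s =
  subst₂ (λ x s → x * t + y * s ≤ x * s + y * t) (m+[n∸m]≡n y≤x) (m+[n∸m]≡n t≤s) $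
  subst ((y + a) * t + y * (t + b) ≤_) (sym expand) (m≤m+n _ (a * b))
  where
  open ℕ-Solver.+-*-Solver
  a b : ℕ
  a = x ∸ y
  b = s ∸ t
  expand : (y + a) * (t + b) + y * t ≡ (y + a) * t + y * (t + b) + a * b
  expand = solve 4 (λ y a t b → (y :+ a) :* (t :+ b) :+ y :* t := (y :+ a) :* t :+ y :* (t :+ b) :+ a :* b)
                   refl y a t b

degreeProduct : (Fin n → ℕ) → Mat n
degreeProduct D u v = D u * D v

module _ {D : Fin n → ℕ} {A A′ : Mat n} where

  M2-mono-switch : NonIncreasing D → Arc D A A′ → M2 D A ≤ M2 D A′
  M2-mono-switch nonInc (_ , _ , i , j , k , l , distinct , i<j , k<l , A′≡A+C) =
    +-cancelʳ-≤ (w i l + w j k) (M2 D A) (M2 D A′) $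
    subst (M2 D A + (w i l + w j k) ≤_) (sym M2-switch) (+-monoʳ-≤ (M2 D A) gain)
    where
    w : Mat n
    w = degreeProduct D
    gain : w i l + w j k ≤ w i k + w j l
    gain = rearrangement (nonInc i j (<⇒≤ i<j)) (nonInc k l (<⇒≤ k<l))
    M2-switch : M2 D A′ + (w i l + w j k) ≡ M2 D A + (w i k + w j l)
    M2-switch = subst₂ (λ x y → x + (w i l + w j k) ≡ y + (w i k + w j l))
      (sym (Σ²≡upperSum (A′ ⊙ w))) (sym (Σ²≡upperSum (A ⊙ w)))
      (upperSum-switch distinct w (λ u v → *-comm (D u) (D v)) A A′ A′≡A+C)

  edges-switch : Arc D A A′ → edges A ≡ edges A′
  edges-switch (_ , _ , i , j , k , l , distinct , _ , _ , A′≡A+C) =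
    sym $ +-cancelʳ-≡ 2 (edges A′) (edges A) $
    subst₂ (λ x y → x + 2 ≡ y + 2) (sym (edges≡weighted A′)) (sym (edges≡weighted A))
      (upperSum-switch distinct one (λ _ _ → refl) A A′ A′≡A+C)
    where
    one : Mat n
    one _ _ = 1
    edges≡weighted : (B : Mat n) → edges B ≡ upperSum (B ⊙ one)
    edges≡weighted B = trans (Σ²≡upperSum B) (upperSum-cong λ u v → sym (*-identityʳ (B u v)))

ℕ/suc-mono-≤ : ∀ {a b} k → a ≤ b → ℤ.+ a ℚ./ suc k ℚ.≤ ℤ.+ b ℚ./ suc k
ℕ/suc-mono-≤ {a} {b} k a≤b = ℚ.toℚᵘ-cancel-≤ $
  ℚᵘ.≤-respˡ-≃ (ℚᵘ.≃-sym (ℚ.toℚᵘ-fromℚᵘ (ℚᵘ.mkℚᵘ (ℤ.+ a) k))) $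
  ℚᵘ.≤-respʳ-≃ (ℚᵘ.≃-sym (ℚ.toℚᵘ-fromℚᵘ (ℚᵘ.mkℚᵘ (ℤ.+ b) k))) $
  ℚᵘ.*≤* $ subst₂ ℤ._≤_ (ℤ.pos-* a (suc k)) (ℤ.pos-* b (suc k)) (ℤ.+≤+ (*-monoˡ-≤ (suc k) a≤b))

Z2sq-mono : {D : Fin n → ℕ} {A A′ : Mat n} → edges A ≡ edges A′ → M2 D A ≤ M2 D A′ →
            Z2sq D A ℚ.≤ Z2sq D A′
Z2sq-mono {A = A} {A′} same-edges M2≤ with edges A | edges A′
Z2sq-mono refl M2≤ | zero  | zero  = ℚ.≤-refl
Z2sq-mono refl M2≤ | suc k | suc k = ℕ/suc-mono-≤ k M2≤

proposition5 : (n : ℕ) (D : Fin n → ℕ) (A A' : Mat n) →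
    NonIncreasing D → 1 ≤ edges A → Arc D A A' →
    M2 D A ≤ M2 D A' × Z2sq D A ℚ.≤ Z2sq D A'
proposition5 n D A A' nonInc _ arc = M2≤ , Z2sq-mono {D = D} (edges-switch {D = D} arc) M2≤
  where
  M2≤ : M2 D A ≤ M2 D A'
  M2≤ = M2-mono-switch {D = D} {A} {A'} nonInc arc
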